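{- Let $n,r$ be positive integers and let $\mathcal{P}(n,r,1)$ be the set of lattice paths with steps $(1,1)$ (up) and $(1,-r)$ (down) from $(0,0)$ to $((r+1)n+1,1)$ (so with $rn+1$ up steps and $n$ down steps). Then: (1) for each $k=1,\dots,rn+1$, the number of paths in $\mathcal{P}(n,r,1)$ that start with an up step and have exactly $k$ up steps starting on or below the $x$-axis is $\frac{1}{rn+1}\binom{(r+1)n}{n}$; (2) for each $k=1,\dots,n$, the number of paths in $\mathcal{P}(n,r,1)$ that start with a down step and have exactly $k$ down steps starting on or below the $x$-axis is $\frac{1}{n}\binom{(r+1)n}{n-1}$; (3) for each $k=1,\dots,(r+1)n+1$, the number of paths in $\mathcal{P}(n,r,1)$ with exactly $k$ vertices on or below the $x$-axis is $\frac{1}{(r+1)n+1}\binom{(r+1)n+1}{n}$.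
   Context: A step starts on or below the $x$-axis if its initial vertex has $y$-coordinate $\le 0$. The vertices of a path are the origin and the successive endpoints of its steps. -}

module Defs where

open import Data.Nat using (ℕ; zero; suc; _+_; _*_)
open import Data.Integer as ℤ using (ℤ; +_; _-_; _≤ᵇ_)
open import Data.Bool using (Bool; true; false; if_then_else_; _∧_)
open import Data.List using (List; []; _∷_; length; filter; map; _++_)
open import Relation.Binary.PropositionalEquality using (_≡_)
open import Relation.Nullary.Decidable using (Dec; yes; no)
open import Data.Nat using (_≟_)

-- A path is a list of steps: true = up step (1,1), false = down step (1,-r).
Step : Set
Step = Bool

allSeqs : ℕ → List (List Step)
allSeqs zero    = [] ∷ []
allSeqs (suc m) = map (true ∷_) (allSeqs m) ++ map (false ∷_) (allSeqs m)

ups : List Step → ℕ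
ups []           = 0
ups (true ∷ s)   = suc (ups s)
ups (false ∷ s)  = ups s

δ : ℕ → Step → ℤ
δ r true  = + 1
δ r false = ℤ.- (+ r)

-- P(n,r,1): paths from (0,0) to ((r+1)n+1, 1) with up steps (1,1) and
-- down steps (1,-r), i.e. length (r+1)n+1 with exactly rn+1 up steps.
isP : ℕ → ℕ → List Step → Bool
isP n r s with ups s ≟ (r * n + 1)
... | yes _ = true
... | no _  = false

P : ℕ → ℕ → List (List Step)
P n r = filter (λ s → Dec-from (isP n r s)) (allSeqs ((r + 1) * n + 1))
  where
  open import Data.Bool using (T)
  open import Relation.Nullary.Decidable using (T?)
  Dec-from : (b : Bool) → Dec (T b)
  Dec-from = T?

upsBelowFrom : ℕ → ℤ → List Step → ℕ
upsBelowFrom r h []          = 0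
upsBelowFrom r h (true ∷ s)  =
  (if h ≤ᵇ + 0 then 1 else 0) + upsBelowFrom r (h ℤ.+ δ r true) s
upsBelowFrom r h (false ∷ s) = upsBelowFrom r (h ℤ.+ δ r false) s

downsBelowFrom : ℕ → ℤ → List Step → ℕ
downsBelowFrom r h []          = 0
downsBelowFrom r h (true ∷ s)  = downsBelowFrom r (h ℤ.+ δ r true) s
downsBelowFrom r h (false ∷ s) =
  (if h ≤ᵇ + 0 then 1 else 0) + downsBelowFrom r (h ℤ.+ δ r false) s

verticesBelowFrom : ℕ → ℤ → List Step → ℕ
verticesBelowFrom r h []      = if h ≤ᵇ + 0 then 1 else 0
verticesBelowFrom r h (x ∷ s) =
  (if h ≤ᵇ + 0 then 1 else 0) + verticesBelowFrom r (h ℤ.+ δ r x) s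

upsBelow : ℕ → List Step → ℕ
upsBelow r = upsBelowFrom r (+ 0)

downsBelow : ℕ → List Step → ℕ
downsBelow r = downsBelowFrom r (+ 0)

verticesBelow : ℕ → List Step → ℕ
verticesBelow r = verticesBelowFrom r (+ 0)

startsUp : List Step → Bool
startsUp (true ∷ _) = true
startsUp _          = false

startsDown : List Step → Bool
startsDown (false ∷ _) = true
startsDown _           = false

count : {A : Set} → (A → Bool) → List A → ℕ
count p []       = 0
count p (x ∷ xs) = (if p x then 1 else 0) + count p xs

eqℕ : ℕ → ℕ → Bool
eqℕ a b with a ≟ b
... | yes _ = true
... | no _  = false

-- Let L = (r+1)n + 1 and let s be a step sequence of length L and displacement 1.
-- Give step j of s the key L·hⱼ − j, where hⱼ is the height at which the step starts. The keys
-- are pairwise distinct, and in the rotation of s that begins with step j, a step starts on or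
-- below the x-axis exactly when its key is at most that of step j. So for steps of a fixed kind
-- (up, down, or all) the number of them starting on or below the axis in that rotation is the
-- rank of step j's key among the keys of that kind, and every k from 1 to the number of such
-- steps is realised by exactly one rotation beginning with a step of that kind. Since rotation
-- permutes the sequences of length L, this gives L · #{paths with statistic k} = C(L, rn+1),
-- and the three formulas follow by absorption and symmetry of binomial coefficients. For the
-- vertex count, all steps are counted and the endpoint, at height 1, is never on or below the axis.

module Submission where

open import Defs
open import Data.Nat using (ℕ; zero; suc; _≟_)
open import Data.Bool using (Bool; true; false; T; not; _∧_; if_then_else_)
open import Data.List using (List; []; _∷_; _++_; _∷ʳ_; [_]; length; map; filter)
open import Data.List.Properties using (length-++; ++-assoc; ++-identityʳ)
open import Data.List.Relation.Unary.All as All using (All; []; _∷_)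
open import Data.List.Relation.Unary.Any using (here; there)
open import Data.List.Membership.Propositional using (_∈_)
open import Data.Product using (Σ; _×_; _,_; proj₁; proj₂)
open import Data.Empty using (⊥-elim)
open import Function using (_∘_; id)
open import Relation.Binary.PropositionalEquality hiding ([_])
open import Relation.Nullary using (does; yes; no; ¬_)
open import Relation.Unary using (Pred; Decidable)
open import Level using (0ℓ)
open import Relation.Nullary.Decidable using (T?)

private variable A B : Set

module Counting where

  open import Data.Nat using (_+_; _≤_; z≤n; s≤s)
  open import Data.Nat.Properties
    using (+-assoc; +-suc; +-mono-≤; ≤-refl; ≤-trans; ≤-reflexive; m≤n+m; suc-injective)
  open import Data.Nat.Tactic.RingSolver using (solve-∀)

  eqℕ-refl : ∀ a → eqℕ a a ≡ true
  eqℕ-refl a with a ≟ a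
  ... | yes _   = refl
  ... | no a≢a = ⊥-elim (a≢a refl)

  eqℕ-≢ : ∀ {a b} → a ≢ b → eqℕ a b ≡ false
  eqℕ-≢ {a} {b} a≢b with a ≟ b
  ... | yes a≡b = ⊥-elim (a≢b a≡b)
  ... | no _    = refl

  eqℕ⇒≡ : ∀ {a b} → eqℕ a b ≡ true → a ≡ b
  eqℕ⇒≡ {a} {b} e with a ≟ b
  ... | yes a≡b = a≡b
  eqℕ⇒≡ () | no _

  eqℕ-suc : ∀ a b → eqℕ (suc a) (suc b) ≡ eqℕ a b
  eqℕ-suc a b with a ≟ b
  ... | yes refl = eqℕ-refl (suc a)
  ... | no a≢b  = eqℕ-≢ (a≢b ∘ suc-injective)

  ind : Bool → ℕ
  ind b = if b then 1 else 0

  sumBy : (A → ℕ) → List A → ℕ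
  sumBy f []       = 0
  sumBy f (x ∷ xs) = f x + sumBy f xs

  count≡sumBy : (p : A → Bool) (xs : List A) → count p xs ≡ sumBy (ind ∘ p) xs
  count≡sumBy p []       = refl
  count≡sumBy p (x ∷ xs) = cong (ind (p x) +_) (count≡sumBy p xs)

  count-cong : {p q : A → Bool} → (∀ x → p x ≡ q x) → ∀ xs → count p xs ≡ count q xs
  count-cong p≗q []       = refl
  count-cong p≗q (x ∷ xs) = cong₂ _+_ (cong ind (p≗q x)) (count-cong p≗q xs)

  count-++ : (p : A → Bool) (xs ys : List A) → count p (xs ++ ys) ≡ count p xs + count p ys
  count-++ p []       ys = refl
  count-++ p (x ∷ xs) ys = trans (cong (ind (p x) +_) (count-++ p xs ys)) (sym (+-assoc (ind (p x)) _ _))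

  sumBy-cong : {f g : A → ℕ} → (∀ x → f x ≡ g x) → ∀ xs → sumBy f xs ≡ sumBy g xs
  sumBy-cong f≗g []       = refl
  sumBy-cong f≗g (x ∷ xs) = cong₂ _+_ (f≗g x) (sumBy-cong f≗g xs)

  sumBy-congᴬ : {f g : A → ℕ} {xs : List A} → All (λ x → f x ≡ g x) xs → sumBy f xs ≡ sumBy g xs
  sumBy-congᴬ []         = refl
  sumBy-congᴬ (e ∷ es) = cong₂ _+_ e (sumBy-congᴬ es)

  sumBy-++ : (f : A → ℕ) (xs ys : List A) → sumBy f (xs ++ ys) ≡ sumBy f xs + sumBy f ys
  sumBy-++ f []       ys = refl
  sumBy-++ f (x ∷ xs) ys = trans (cong (f x +_) (sumBy-++ f xs ys)) (sym (+-assoc (f x) _ _))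

  sumBy-map : (f : B → ℕ) (g : A → B) (xs : List A) → sumBy f (map g xs) ≡ sumBy (f ∘ g) xs
  sumBy-map f g []       = refl
  sumBy-map f g (x ∷ xs) = cong (f (g x) +_) (sumBy-map f g xs)

  +-interchange : ∀ a b c d → (a + b) + (c + d) ≡ (a + c) + (b + d)
  +-interchange = solve-∀

  sumBy-+ : (f g : A → ℕ) (xs : List A) → sumBy (λ x → f x + g x) xs ≡ sumBy f xs + sumBy g xs
  sumBy-+ f g []       = refl
  sumBy-+ f g (x ∷ xs) =
    trans (cong (f x + g x +_) (sumBy-+ f g xs)) (+-interchange (f x) (g x) (sumBy f xs) (sumBy g xs))

  sumBy-zero : (xs : List A) → sumBy (λ _ → 0) xs ≡ 0
  sumBy-zero []       = refl
  sumBy-zero (x ∷ xs) = sumBy-zero xs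

  sumBy-const : (xs : List A) → sumBy (λ _ → 1) xs ≡ length xs
  sumBy-const []       = refl
  sumBy-const (x ∷ xs) = cong suc (sumBy-const xs)

  sumBy-filter : {P : Pred A 0ℓ} (P? : Decidable P) (f : A → ℕ) (xs : List A) →
    sumBy f (filter P? xs) ≡ sumBy (λ x → if does (P? x) then f x else 0) xs
  sumBy-filter P? f [] = refl
  sumBy-filter P? f (x ∷ xs) with does (P? x)
  ... | true  = cong (f x +_) (sumBy-filter P? f xs)
  ... | false = sumBy-filter P? f xs

  ind-mono : ∀ {b c} → (T b → T c) → ind b ≤ ind c
  ind-mono {false} _   = z≤n
  ind-mono {true} {true}  _   = ≤-refl
  ind-mono {true} {false} b⇒c = ⊥-elim (b⇒c _)

  count-mono : {p q : A → Bool} → (∀ x → T (p x) → T (q x)) → ∀ xs → count p xs ≤ count q xs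
  count-mono p⇒q []       = z≤n
  count-mono p⇒q (x ∷ xs) = +-mono-≤ (ind-mono (p⇒q x)) (count-mono p⇒q xs)

  count-mono-strict : {p q : A → Bool} → (∀ x → T (p x) → T (q x)) →
    ∀ {x xs} → x ∈ xs → ¬ T (p x) → T (q x) → suc (count p xs) ≤ count q xs
  count-mono-strict {p = p} {q} p⇒q {xs = y ∷ ys} (here refl) ¬px qx with p y | q y
  ... | false | true  = s≤s (count-mono p⇒q ys)
  ... | true  | _     = ⊥-elim (¬px _)
  count-mono-strict {p = p} p⇒q {xs = y ∷ ys} (there x∈ys) ¬px qx =
    ≤-trans (≤-reflexive (sym (+-suc (ind (p y)) _))) (+-mono-≤ (ind-mono (p⇒q y)) (count-mono-strict p⇒q x∈ys ¬px qx))

  count-pos : {p : A → Bool} {x : A} {xs : List A} → x ∈ xs → T (p x) → 1 ≤ count p xs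
  count-pos {p = p} {xs = y ∷ ys} (here refl) px with p y
  ... | true = s≤s z≤n
  count-pos {p = p} {xs = y ∷ ys} (there x∈ys) px = ≤-trans (count-pos x∈ys px) (m≤n+m _ (ind (p y)))

  count≤length : (p : A → Bool) (xs : List A) → count p xs ≤ length xs
  count≤length p []       = z≤n
  count≤length p (x ∷ xs) = +-mono-≤ (ind-mono {c = true} _) (count≤length p xs)

  count-none : {p : A → Bool} {xs : List A} → All (λ x → p x ≡ false) xs → count p xs ≡ 0
  count-none                  []          = refl
  count-none {p = p} {x ∷ xs} (px ∷ pxs) = trans (cong (λ b → ind b + count p xs) px) (count-none pxs)


module Rotations where

  open Counting
  open import Data.Nat using (_+_; _*_)
  open import Data.Nat.Properties using (+-comm; +-identityʳ)
  open import Data.Nat.Combinatorics using (_C_; nCk+nC[k+1]≡[n+1]C[k+1])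
  open ≡-Reasoning

  sumBy-allSeqs-suc : ∀ m (H : List Step → ℕ) →
    sumBy H (allSeqs (suc m)) ≡ sumBy (H ∘ (true ∷_)) (allSeqs m) + sumBy (H ∘ (false ∷_)) (allSeqs m)
  sumBy-allSeqs-suc m H =
    trans (sumBy-++ H (map (true ∷_) S) _) (cong₂ _+_ (sumBy-map H _ S) (sumBy-map H _ S))
    where S = allSeqs m

  sumBy-allSeqs-∷ʳ : ∀ m (H : List Step → ℕ) →
    sumBy H (allSeqs (suc m)) ≡ sumBy (H ∘ (_∷ʳ true)) (allSeqs m) + sumBy (H ∘ (_∷ʳ false)) (allSeqs m)
  sumBy-allSeqs-∷ʳ zero H = cong (_+ (H [ false ] + 0)) (sym (+-identityʳ (H [ true ])))
  sumBy-allSeqs-∷ʳ (suc m) H = begin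
      sumBy H (allSeqs (suc (suc m)))
    ≡⟨ sumBy-allSeqs-suc (suc m) H ⟩
      sumBy (H ∘ (true ∷_)) (allSeqs (suc m)) + sumBy (H ∘ (false ∷_)) (allSeqs (suc m))
    ≡⟨ cong₂ _+_ (sumBy-allSeqs-∷ʳ m (H ∘ (true ∷_))) (sumBy-allSeqs-∷ʳ m (H ∘ (false ∷_))) ⟩
      (S true true + S true false) + (S false true + S false false)
    ≡⟨ +-interchange (S true true) (S true false) (S false true) (S false false) ⟩
      (S true true + S false true) + (S true false + S false false)
    ≡⟨ sym (cong₂ _+_ (sumBy-allSeqs-suc m (H ∘ (_∷ʳ true))) (sumBy-allSeqs-suc m (H ∘ (_∷ʳ false)))) ⟩
      sumBy (H ∘ (_∷ʳ true)) (allSeqs (suc m)) + sumBy (H ∘ (_∷ʳ false)) (allSeqs (suc m))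
    ∎
    where
    S : Step → Step → ℕ
    S x y = sumBy (λ s → H (x ∷ (s ∷ʳ y))) (allSeqs m)

  sumBy-allSeqs-cong : ∀ m {F G : List Step → ℕ} → (∀ s → length s ≡ m → F s ≡ G s) →
    sumBy F (allSeqs m) ≡ sumBy G (allSeqs m)
  sumBy-allSeqs-cong zero    F≗G = cong (_+ 0) (F≗G [] refl)
  sumBy-allSeqs-cong (suc m) {F} {G} F≗G = begin
      sumBy F (allSeqs (suc m))
    ≡⟨ sumBy-allSeqs-suc m F ⟩
      sumBy (F ∘ (true ∷_)) (allSeqs m) + sumBy (F ∘ (false ∷_)) (allSeqs m)
    ≡⟨ cong₂ _+_ (sumBy-allSeqs-cong m (λ s l → F≗G (true ∷ s) (cong suc l)))
                 (sumBy-allSeqs-cong m (λ s l → F≗G (false ∷ s) (cong suc l))) ⟩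
      sumBy (G ∘ (true ∷_)) (allSeqs m) + sumBy (G ∘ (false ∷_)) (allSeqs m)
    ≡⟨ sym (sumBy-allSeqs-suc m G) ⟩
      sumBy G (allSeqs (suc m))
    ∎

  sumBy-allSeqs-ups : ∀ m u → sumBy (λ s → ind (eqℕ (ups s) u)) (allSeqs m) ≡ m C u
  sumBy-allSeqs-ups zero    zero    = refl
  sumBy-allSeqs-ups zero    (suc u) = refl
  sumBy-allSeqs-ups (suc m) u = trans (sumBy-allSeqs-suc m _) (pascal u)
    where
    N : ℕ → ℕ
    N u = sumBy (λ s → ind (eqℕ (ups s) u)) (allSeqs m)
    pascal : ∀ u → sumBy (λ s → ind (eqℕ (suc (ups s)) u)) (allSeqs m) + N u ≡ suc m C u
    pascal zero    = trans (cong (_+ N 0) (sumBy-zero (allSeqs m))) (sumBy-allSeqs-ups m zero)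
    pascal (suc u) = begin
        sumBy (λ s → ind (eqℕ (suc (ups s)) (suc u))) (allSeqs m) + N (suc u)
      ≡⟨ cong (_+ N (suc u)) (sumBy-cong (λ s → cong ind (eqℕ-suc (ups s) u)) (allSeqs m)) ⟩
        N u + N (suc u)
      ≡⟨ cong₂ _+_ (sumBy-allSeqs-ups m u) (sumBy-allSeqs-ups m (suc u)) ⟩
        m C u + m C suc u
      ≡⟨ nCk+nC[k+1]≡[n+1]C[k+1] m u ⟩
        suc m C suc u
      ∎

  rotate : List Step → List Step
  rotate []      = []
  rotate (x ∷ s) = s ∷ʳ x

  sumBy-allSeqs-rotate : ∀ m (H : List Step → ℕ) → sumBy (H ∘ rotate) (allSeqs m) ≡ sumBy H (allSeqs m)
  sumBy-allSeqs-rotate zero    H = refl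
  sumBy-allSeqs-rotate (suc m) H = trans (sumBy-allSeqs-suc m (H ∘ rotate)) (sym (sumBy-allSeqs-∷ʳ m H))

  ups-++ : ∀ s t → ups (s ++ t) ≡ ups s + ups t
  ups-++ []          t = refl
  ups-++ (true ∷ s)  t = cong suc (ups-++ s t)
  ups-++ (false ∷ s) t = ups-++ s t

  ups-rotate : ∀ s → ups (rotate s) ≡ ups s
  ups-rotate []          = refl
  ups-rotate (true ∷ s)  = trans (ups-++ s [ true ]) (+-comm (ups s) 1)
  ups-rotate (false ∷ s) = trans (ups-++ s [ false ]) (+-identityʳ (ups s))

  orbitSum : (List Step → ℕ) → ℕ → List Step → ℕ
  orbitSum G zero    s = 0
  orbitSum G (suc k) s = G s + orbitSum G k (rotate s)

  orbitSum-cong : (I : List Step → Set) → (∀ {s} → I s → I (rotate s)) →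
    {G₁ G₂ : List Step → ℕ} → (∀ {t} → I t → G₁ t ≡ G₂ t) → ∀ k {s} → I s → orbitSum G₁ k s ≡ orbitSum G₂ k s
  orbitSum-cong I I-rotate G₁≗G₂ zero    i = refl
  orbitSum-cong I I-rotate G₁≗G₂ (suc k) i = cong₂ _+_ (G₁≗G₂ i) (orbitSum-cong I I-rotate G₁≗G₂ k (I-rotate i))

  orbitSum-guard : (Q : List Step → Bool) → (∀ s → Q (rotate s) ≡ Q s) → ∀ (g : List Step → ℕ) k s →
    orbitSum (λ t → if Q t then g t else 0) k s ≡ (if Q s then orbitSum g k s else 0)
  orbitSum-guard Q Q-rotate g zero s with Q s
  ... | true  = refl
  ... | false = refl
  orbitSum-guard Q Q-rotate g (suc k) s rewrite orbitSum-guard Q Q-rotate g k (rotate s) | Q-rotate s with Q s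
  ... | true  = refl
  ... | false = refl

  sumBy-allSeqs-orbitSum : ∀ m (G : List Step → ℕ) k → sumBy (orbitSum G k) (allSeqs m) ≡ k * sumBy G (allSeqs m)
  sumBy-allSeqs-orbitSum m G zero    = sumBy-zero (allSeqs m)
  sumBy-allSeqs-orbitSum m G (suc k) = begin
      sumBy (λ s → G s + orbitSum G k (rotate s)) (allSeqs m)
    ≡⟨ sumBy-+ G (orbitSum G k ∘ rotate) (allSeqs m) ⟩
      sumBy G (allSeqs m) + sumBy (orbitSum G k ∘ rotate) (allSeqs m)
    ≡⟨ cong (sumBy G (allSeqs m) +_) (sumBy-allSeqs-rotate m (orbitSum G k)) ⟩
      sumBy G (allSeqs m) + sumBy (orbitSum G k) (allSeqs m)
    ≡⟨ cong (sumBy G (allSeqs m) +_) (sumBy-allSeqs-orbitSum m G k) ⟩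
      sumBy G (allSeqs m) + k * sumBy G (allSeqs m)
    ∎

  count-filter-by-orbits : ∀ m (Q g : List Step → Bool) → (∀ s → Q (rotate s) ≡ Q s) →
    (∀ s → length s ≡ m → Q s ≡ true → orbitSum (ind ∘ g) m s ≡ 1) →
    m * count g (filter (T? ∘ Q) (allSeqs m)) ≡ count Q (allSeqs m)
  count-filter-by-orbits m Q g Q-rotate one-per-orbit = begin
      m * count g (filter (T? ∘ Q) (allSeqs m))
    ≡⟨ cong (m *_) (trans (count≡sumBy g (filter (T? ∘ Q) (allSeqs m))) (sumBy-filter (T? ∘ Q) (ind ∘ g) (allSeqs m))) ⟩
      m * sumBy guarded (allSeqs m)
    ≡⟨ sym (sumBy-allSeqs-orbitSum m guarded m) ⟩
      sumBy (orbitSum guarded m) (allSeqs m)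
    ≡⟨ sumBy-allSeqs-cong m orbit ⟩
      sumBy (ind ∘ Q) (allSeqs m)
    ≡⟨ sym (count≡sumBy Q (allSeqs m)) ⟩
      count Q (allSeqs m)
    ∎
    where
    guarded : List Step → ℕ
    guarded s = if Q s then ind (g s) else 0
    orbit : ∀ s → length s ≡ m → orbitSum guarded m s ≡ ind (Q s)
    orbit s len rewrite orbitSum-guard Q Q-rotate (ind ∘ g) m s with Q s in e
    ... | true  = one-per-orbit s len e
    ... | false = refl


module Pigeonhole where

  open Counting
  open import Data.Nat using (_+_; _≤_; _<_; z≤n; s≤s)
  open import Data.Nat.Properties
    using (≤-reflexive; <-trans; +-mono-≤; <⇒≢; <⇒≱; n<1+n; <-irrefl; m<1+n⇒m≤n; m≤n⇒m<n∨m≡n; suc-injective)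
  open import Data.List.Relation.Unary.AllPairs using (AllPairs; []; _∷_)
  open import Data.Sum using (inj₁; inj₂)
  open ≡-Reasoning

  oneTo : ℕ → List ℕ
  oneTo zero    = []
  oneTo (suc m) = suc m ∷ oneTo m

  length-oneTo : ∀ m → length (oneTo m) ≡ m
  length-oneTo zero    = refl
  length-oneTo (suc m) = cong suc (length-oneTo m)

  All-oneTo : {P : ℕ → Set} → ∀ {m k} → All P (oneTo m) → 1 ≤ k → k ≤ m → P k
  All-oneTo {m = zero}  _         1≤k k≤m = ⊥-elim (<⇒≱ 1≤k k≤m)
  All-oneTo {m = suc m} (Pm ∷ Ps) 1≤k k≤m with m≤n⇒m<n∨m≡n k≤m
  ... | inj₂ refl = Pm
  ... | inj₁ k<m  = All-oneTo Ps 1≤k (m<1+n⇒m≤n k<m)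

  count-oneTo-above : ∀ {a} m → m < a → count (eqℕ a) (oneTo m) ≡ 0
  count-oneTo-above zero    _   = refl
  count-oneTo-above (suc m) m<a rewrite eqℕ-≢ (<⇒≢ m<a ∘ sym) = count-oneTo-above m (<-trans (n<1+n m) m<a)

  count-oneTo-eqℕ : ∀ {a} m → 1 ≤ a → a ≤ m → count (eqℕ a) (oneTo m) ≡ 1
  count-oneTo-eqℕ zero    1≤a a≤0 = ⊥-elim (<⇒≱ 1≤a a≤0)
  count-oneTo-eqℕ (suc m) 1≤a a≤m with m≤n⇒m<n∨m≡n a≤m
  ... | inj₂ refl rewrite eqℕ-refl (suc m) = cong suc (count-oneTo-above m (n<1+n m))
  ... | inj₁ a<m  rewrite eqℕ-≢ (<⇒≢ a<m) = count-oneTo-eqℕ m 1≤a (m<1+n⇒m≤n a<m)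

  sumBy-count-swap : (R : A → B → Bool) (xs : List A) (ys : List B) →
    sumBy (λ y → count (λ x → R x y) xs) ys ≡ sumBy (λ x → count (R x) ys) xs
  sumBy-count-swap R xs []       = sym (sumBy-zero xs)
  sumBy-count-swap R xs (y ∷ ys) = begin
      count (λ x → R x y) xs + sumBy (λ y → count (λ x → R x y) xs) ys
    ≡⟨ cong₂ _+_ (count≡sumBy (λ x → R x y) xs) (sumBy-count-swap R xs ys) ⟩
      sumBy (λ x → ind (R x y)) xs + sumBy (λ x → count (R x) ys) xs
    ≡⟨ sym (sumBy-+ (λ x → ind (R x y)) (λ x → count (R x) ys) xs) ⟩
      sumBy (λ x → count (R x) (y ∷ ys)) xs
    ∎

  count-eqℕ≤1 : (g : A → ℕ) {xs : List A} → AllPairs (λ x y → g x ≢ g y) xs →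
    ∀ k → count (λ x → eqℕ (g x) k) xs ≤ 1
  count-eqℕ≤1 g []           k = z≤n
  count-eqℕ≤1 g {x ∷ xs} (gx≢ ∷ g-inj) k with eqℕ (g x) k in gx≡k
  ... | false = count-eqℕ≤1 g g-inj k
  ... | true  = s≤s (≤-reflexive (count-none (All.map miss gx≢)))
    where
    miss : ∀ {y} → g x ≢ g y → eqℕ (g y) k ≡ false
    miss gx≢gy = eqℕ-≢ (λ gy≡k → gx≢gy (trans (eqℕ⇒≡ gx≡k) (sym gy≡k)))

  +-≤-tight : ∀ {a b m} → a ≤ 1 → b ≤ m → a + b ≡ suc m → a ≡ 1 × b ≡ m
  +-≤-tight {zero}        _         b≤m b≡1+m = ⊥-elim (<-irrefl refl (subst (_≤ _) b≡1+m b≤m))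
  +-≤-tight {suc zero}    _         _   1+b≡1+m = refl , suc-injective 1+b≡1+m
  +-≤-tight {suc (suc a)} (s≤s ()) _   _

  sumBy≤length : {f : A → ℕ} {xs : List A} → All (λ x → f x ≤ 1) xs → sumBy f xs ≤ length xs
  sumBy≤length []           = z≤n
  sumBy≤length (fx≤1 ∷ fs) = +-mono-≤ fx≤1 (sumBy≤length fs)

  sumBy≡length⇒all≡1 : {f : A → ℕ} {xs : List A} → All (λ x → f x ≤ 1) xs →
    sumBy f xs ≡ length xs → All (λ x → f x ≡ 1) xs
  sumBy≡length⇒all≡1 []           _  = []
  sumBy≡length⇒all≡1 (fx≤1 ∷ fs) eq with fx≡1 , rest ← +-≤-tight fx≤1 (sumBy≤length fs) eq =
    fx≡1 ∷ sumBy≡length⇒all≡1 fs rest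

  injective-into-range-hits-once : (g : A → ℕ) (xs : List A) →
    AllPairs (λ x y → g x ≢ g y) xs → All (λ x → 1 ≤ g x × g x ≤ length xs) xs →
    ∀ k → 1 ≤ k → k ≤ length xs → count (λ x → eqℕ (g x) k) xs ≡ 1
  injective-into-range-hits-once g xs g-inj g-range k 1≤k k≤n =
    All-oneTo (sumBy≡length⇒all≡1 (All.universal (count-eqℕ≤1 g g-inj) (oneTo n)) total) 1≤k k≤n
    where
    n = length xs
    total : sumBy (λ k → count (λ x → eqℕ (g x) k) xs) (oneTo n) ≡ length (oneTo n)
    total = begin
        sumBy (λ k → count (λ x → eqℕ (g x) k) xs) (oneTo n)
      ≡⟨ sumBy-count-swap (λ x k → eqℕ (g x) k) xs (oneTo n) ⟩
        sumBy (λ x → count (eqℕ (g x)) (oneTo n)) xs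
      ≡⟨ sumBy-congᴬ (All.map (λ (1≤gx , gx≤n) → count-oneTo-eqℕ n 1≤gx gx≤n) g-range) ⟩
        sumBy (λ _ → 1) xs
      ≡⟨ sumBy-const xs ⟩
        n
      ≡⟨ sym (length-oneTo n) ⟩
        length (oneTo n)
      ∎


module Integers where

  open import Data.Integer using (+_; -[1+_]; 0ℤ; _≤ᵇ_; _≤_; _-_; _*_; -≤+; +≤+)
  open import Data.Integer.Properties
    using (≤⇒≤ᵇ; ≤ᵇ⇒≤; ≤-refl; ≤-trans; ≤-reflexive; drop‿+≤+; pos-*; *-zeroʳ; *-monoˡ-≤-nonNeg; i-j≤0⇒i≤j; i≤j⇒i-j≤0)
  import Data.Nat as ℕ
  import Data.Nat.Properties as ℕ
  open import Function.Bundles using (_⇔_; mk⇔)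
  open import Relation.Nullary using (Dec)
  open import Relation.Nullary.Decidable using (does-⇔; map′)

  ≤ᵇ-cong : ∀ {a b c d} → (a ≤ b ⇔ c ≤ d) → (a ≤ᵇ b) ≡ (c ≤ᵇ d)
  ≤ᵇ-cong {a} {b} {c} {d} a≤b⇔c≤d = does-⇔ a≤b⇔c≤d (≤ᵇ-dec a b) (≤ᵇ-dec c d)
    where
    ≤ᵇ-dec : ∀ i j → Dec (i ≤ j)
    ≤ᵇ-dec i j = map′ ≤ᵇ⇒≤ ≤⇒≤ᵇ (T? (i ≤ᵇ j))

  i-j≤ᵇ0≡i≤ᵇj : ∀ i j → (i - j ≤ᵇ 0ℤ) ≡ (i ≤ᵇ j)
  i-j≤ᵇ0≡i≤ᵇj i j = ≤ᵇ-cong {i - j} {0ℤ} {i} {j} (mk⇔ i-j≤0⇒i≤j i≤j⇒i-j≤0)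

  d≤0⇒L*d≤j : ∀ L j {d} → d ≤ 0ℤ → + L * d ≤ + j
  d≤0⇒L*d≤j L j d≤0 = ≤-trans (≤-trans (*-monoˡ-≤-nonNeg (+ L) d≤0) (≤-reflexive (*-zeroʳ (+ L)))) (+≤+ ℕ.z≤n)

  L*d≤j⇒d≤0 : ∀ {L j} → j ℕ.< L → ∀ d → + L * d ≤ + j → d ≤ 0ℤ
  L*d≤j⇒d≤0 j<L (+ zero)  _ = ≤-refl
  L*d≤j⇒d≤0 j<L -[1+ m ]  _ = -≤+
  L*d≤j⇒d≤0 {L} {j} j<L (+ suc m) L*d≤j =
    ⊥-elim (ℕ.<⇒≱ j<L (ℕ.≤-trans (ℕ.m≤m*n L (suc m)) (drop‿+≤+ (subst (_≤ + j) (sym (pos-* L (suc m))) L*d≤j))))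

  L*d-j≤ᵇ0≡d≤ᵇ0 : ∀ {L j} → j ℕ.< L → ∀ d → (+ L * d - + j ≤ᵇ 0ℤ) ≡ (d ≤ᵇ 0ℤ)
  L*d-j≤ᵇ0≡d≤ᵇ0 {L} {j} j<L d =
    trans (i-j≤ᵇ0≡i≤ᵇj (+ L * d) (+ j)) (≤ᵇ-cong (mk⇔ (L*d≤j⇒d≤0 j<L d) (d≤0⇒L*d≤j L j)))

  L*d≢j : ∀ {L j} → 0 ℕ.< j → j ℕ.< L → ∀ d → + L * d ≢ + j
  L*d≢j {L} {j} 0<j j<L d L*d≡j =
    ℕ.<⇒≱ 0<j (drop‿+≤+ (subst (_≤ + 0) L*d≡j (d≤0⇒L*d≤j L 0 (L*d≤j⇒d≤0 j<L d (≤-reflexive L*d≡j)))))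


module Ranks where

  open Counting
  open Pigeonhole using (injective-into-range-hits-once)
  open import Data.Nat using (_≤_; _<_)
  open import Data.Integer using (ℤ; _≤ᵇ_) renaming (_≤_ to _≤ℤ_; _<_ to _<ℤ_)
  open import Data.Integer.Properties using (≤⇒≤ᵇ; ≤ᵇ⇒≤; ≤-refl; ≤-trans; <⇒≤; <⇒≱; ≤-total; ≤∧≢⇒<)
  import Data.Nat.Properties as ℕ
  open import Data.List.Relation.Unary.AllPairs using (AllPairs; []; _∷_)
  open import Data.Sum using (inj₁; inj₂)

  rank : ℤ → List ℤ → ℕ
  rank w V = count (_≤ᵇ w) V

  rank-< : ∀ {w u V} → w <ℤ u → u ∈ V → rank w V < rank u V
  rank-< {w} {u} w<u u∈V = count-mono-strict
    (λ v v≤w → ≤⇒≤ᵇ (≤-trans (≤ᵇ⇒≤ {v} {w} v≤w) (<⇒≤ w<u))) u∈V (λ u≤w → <⇒≱ w<u (≤ᵇ⇒≤ {u} {w} u≤w)) (≤⇒≤ᵇ (≤-refl {u}))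

  rank-injective : ∀ {w u V} → w ∈ V → u ∈ V → w ≢ u → rank w V ≢ rank u V
  rank-injective {w} {u} w∈V u∈V w≢u with ≤-total w u
  ... | inj₁ w≤u = ℕ.<⇒≢ (rank-< (≤∧≢⇒< w≤u w≢u) u∈V)
  ... | inj₂ u≤w = ℕ.<⇒≢ (rank-< (≤∧≢⇒< u≤w (w≢u ∘ sym)) w∈V) ∘ sym

  ranks-distinct : ∀ {V W} → All (_∈ V) W → AllPairs _≢_ W → AllPairs (λ w u → rank w V ≢ rank u V) W
  ranks-distinct []            []           = []
  ranks-distinct (w∈V ∷ W⊆V) (w≢W ∷ W≢) =
    All.zipWith (λ (u∈V , w≢u) → rank-injective w∈V u∈V w≢u) (W⊆V , w≢W) ∷ ranks-distinct W⊆V W≢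

  rank-hits-once : ∀ V → AllPairs _≢_ V → ∀ k → 1 ≤ k → k ≤ length V → count (λ w → eqℕ (rank w V) k) V ≡ 1
  rank-hits-once V V≢ = injective-into-range-hits-once (λ w → rank w V) V
    (ranks-distinct (All.tabulate id) V≢)
    (All.tabulate (λ {w} w∈V → count-pos w∈V (≤⇒≤ᵇ (≤-refl {w})) , count≤length _ V))


module CycleLemma where

  open Counting
  open Rotations using (rotate; orbitSum)
  open Integers
  open Ranks
  import Data.Nat as ℕ
  import Data.Nat.Properties as ℕ
  open import Data.Integer using (ℤ; +_; 0ℤ; _+_; _-_; _*_; _≤ᵇ_)
  open import Data.Integer.Properties using (+-identityˡ; +-identityʳ; +-assoc; +-comm; +-inverseʳ; *-identityʳ; m-n≡m⊖n; ⊖-≥)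
  open import Data.List.Relation.Unary.AllPairs using (AllPairs; []; _∷_)
  open import Data.Integer.Tactic.RingSolver using (solve-∀)
  open ≡-Reasoning

  displacement : ℕ → List Step → ℤ
  displacement r []      = 0ℤ
  displacement r (x ∷ s) = δ r x + displacement r s

  displacement-++ : ∀ r a b → displacement r (a ++ b) ≡ displacement r a + displacement r b
  displacement-++ r []      b = sym (+-identityˡ _)
  displacement-++ r (x ∷ a) b = trans (cong (_+_ (δ r x)) (displacement-++ r a b)) (sym (+-assoc (δ r x) _ _))

  displacement-∷ʳ : ∀ r a y → displacement r (a ∷ʳ y) ≡ displacement r a + δ r y
  displacement-∷ʳ r a y = trans (displacement-++ r a [ y ]) (cong (_+_ (displacement r a)) (+-identityʳ (δ r y)))

  displacement-rotate : ∀ r s → displacement r (rotate s) ≡ displacement r s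
  displacement-rotate r []      = refl
  displacement-rotate r (x ∷ s) = trans (displacement-∷ʳ r s x) (+-comm (displacement r s) (δ r x))

  lowSteps : ℕ → (Step → Bool) → ℤ → List Step → ℕ
  lowSteps r p h []      = 0
  lowSteps r p h (x ∷ s) = ind (p x ∧ (h ≤ᵇ 0ℤ)) ℕ.+ lowSteps r p (h + δ r x) s

  Key : Set
  Key = Step × ℤ

  keys : ℕ → ℕ → ℤ → ℤ → List Step → List Key
  keys r L h i []      = []
  keys r L h i (x ∷ s) = (x , + L * h - i) ∷ keys r L (h + δ r x) (i + + 1) s

  rankAmong : (Step → Bool) → List Key → ℤ → ℕ
  rankAmong p ks w = count (λ e → p (proj₁ e) ∧ (proj₂ e ≤ᵇ w)) ks

  shift : ℤ → Key → Key
  shift d (x , v) = x , v + d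

  lowSteps≡rankAmong : ∀ r L p h n c → n ℕ.+ length c ℕ.≤ L → lowSteps r p h c ≡ rankAmong p (keys r L h (+ n) c) 0ℤ
  lowSteps≡rankAmong r L p h n []      _    = refl
  lowSteps≡rankAmong r L p h n (x ∷ c) n+c≤L =
    cong₂ ℕ._+_ (cong (λ b → ind (p x ∧ b)) (sym (L*d-j≤ᵇ0≡d≤ᵇ0 n<L h)))
                (lowSteps≡rankAmong r L p (h + δ r x) (n ℕ.+ 1) c (subst (ℕ._≤ L) (sym (ℕ.+-assoc n 1 (length c))) n+c≤L))
    where
    n<L : n ℕ.< L
    n<L = ℕ.<-≤-trans (ℕ.m<m+n n (ℕ.s≤s ℕ.z≤n)) n+c≤L

  keys-++ : ∀ r L h i a b → keys r L h i (a ++ b) ≡ keys r L h i a ++ keys r L (h + displacement r a) (i + + length a) b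
  keys-++ r L h i []      b = cong₂ (λ h′ i′ → keys r L h′ i′ b) (sym (+-identityʳ h)) (sym (+-identityʳ i))
  keys-++ r L h i (x ∷ a) b = cong ((x , + L * h - i) ∷_) (trans (keys-++ r L (h + δ r x) (i + + 1) a b)
    (cong (keys r L (h + δ r x) (i + + 1) a ++_)
          (cong₂ (λ h′ i′ → keys r L h′ i′ b) (+-assoc h (δ r x) (displacement r a)) (+-assoc i (+ 1) (+ length a)))))

  keys-shift : ∀ r L h i Δ ι c → keys r L (h + Δ) (i + ι) c ≡ map (shift (+ L * Δ - ι)) (keys r L h i c)
  keys-shift r L h i Δ ι []      = refl
  keys-shift r L h i Δ ι (x ∷ c) = cong₂ _∷_ (cong (x ,_) (distrib (+ L) h Δ i ι))
    (trans (cong₂ (λ h′ i′ → keys r L h′ i′ c) (swap h Δ (δ r x)) (swap i ι (+ 1)))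
           (keys-shift r L (h + δ r x) (i + + 1) Δ ι c))
    where
    distrib : ∀ L h Δ i ι → L * (h + Δ) - (i + ι) ≡ (L * h - i) + (L * Δ - ι)
    distrib = solve-∀
    swap : ∀ a b c → a + b + c ≡ (a + c) + b
    swap = solve-∀

  +-≤ᵇ-shift : ∀ v d w → (v + d ≤ᵇ w) ≡ (v ≤ᵇ w - d)
  +-≤ᵇ-shift v d w = trans (sym (i-j≤ᵇ0≡i≤ᵇj (v + d) w))
    (trans (cong (_≤ᵇ 0ℤ) (assoc v d w)) (i-j≤ᵇ0≡i≤ᵇj v (w - d)))
    where
    assoc : ∀ v d w → v + d - w ≡ v - (w - d)
    assoc = solve-∀

  rankAmong-shift : ∀ p d ks w → rankAmong p (map (shift d) ks) w ≡ rankAmong p ks (w - d)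
  rankAmong-shift p d []             w = refl
  rankAmong-shift p d ((x , v) ∷ ks) w =
    cong₂ ℕ._+_ (cong (λ b → ind (p x ∧ b)) (+-≤ᵇ-shift v d w)) (rankAmong-shift p d ks w)

  rankAmong-++ : ∀ p ks ks′ w → rankAmong p (ks ++ ks′) w ≡ rankAmong p ks w ℕ.+ rankAmong p ks′ w
  rankAmong-++ p ks ks′ w = count-++ _ ks ks′

  prefixKey : ℕ → ℕ → List Step → ℤ
  prefixKey r L a = + L * displacement r a - + length a

  prefixKey-complement : ∀ r L a c → displacement r (a ++ c) ≡ + 1 → length (a ++ c) ≡ L →
    0ℤ - prefixKey r L c ≡ prefixKey r L a
  prefixKey-complement r L a c a+c≡1 |a+c|≡L = begin
      0ℤ - (+ L * Sc - + lc)
    ≡⟨ regroup (+ L) Sa Sc (+ la) (+ lc) ⟩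
      w + ((+ la + + lc) - + L * (Sa + Sc))
    ≡⟨ cong₂ (λ u v → w + (u - + L * v)) (cong +_ (trans (sym (length-++ a)) |a+c|≡L))
                                           (trans (sym (displacement-++ r a c)) a+c≡1) ⟩
      w + (+ L - + L * + 1)
    ≡⟨ cong (λ z → w + (+ L - z)) (*-identityʳ (+ L)) ⟩
      w + (+ L - + L)
    ≡⟨ trans (cong (_+_ w) (+-inverseʳ (+ L))) (+-identityʳ w) ⟩
      w
    ∎
    where
    Sa = displacement r a
    Sc = displacement r c
    la = length a
    lc = length c
    w  = prefixKey r L a
    regroup : ∀ L Sa Sc la lc → 0ℤ - (L * Sc - lc) ≡ (L * Sa - la) + ((la + lc) - L * (Sa + Sc))
    regroup = solve-∀

  -- The keys of the rotation c ++ a are those of s = a ++ c, all shifted by −w.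
  lowSteps-rotation : ∀ r L p a c → displacement r (a ++ c) ≡ + 1 → length (a ++ c) ≡ L →
    lowSteps r p 0ℤ (c ++ a) ≡ rankAmong p (keys r L 0ℤ 0ℤ (a ++ c)) (prefixKey r L a)
  lowSteps-rotation r L p a c a+c≡1 |a+c|≡L = begin
      lowSteps r p 0ℤ (c ++ a)
    ≡⟨ lowSteps≡rankAmong r L p 0ℤ 0 (c ++ a) (ℕ.≤-reflexive |c+a|≡L) ⟩
      rankAmong p (keys r L 0ℤ 0ℤ (c ++ a)) 0ℤ
    ≡⟨ cong (λ ks → rankAmong p ks 0ℤ) (keys-++ r L 0ℤ 0ℤ c a) ⟩
      rankAmong p (Kc ++ keys r L (0ℤ + displacement r c) (0ℤ + + length c) a) 0ℤ
    ≡⟨ rankAmong-++ p Kc _ 0ℤ ⟩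
      rankAmong p Kc 0ℤ ℕ.+ rankAmong p (keys r L (0ℤ + displacement r c) (0ℤ + + length c) a) 0ℤ
    ≡⟨ cong (rankAmong p Kc 0ℤ ℕ.+_) (trans (cong (λ ks → rankAmong p ks 0ℤ) (keys-shift r L 0ℤ 0ℤ _ _ a))
                                              (rankAmong-shift p _ Ka 0ℤ)) ⟩
      rankAmong p Kc 0ℤ ℕ.+ rankAmong p Ka (0ℤ - prefixKey r L c)
    ≡⟨ cong (λ w′ → rankAmong p Kc 0ℤ ℕ.+ rankAmong p Ka w′) (prefixKey-complement r L a c a+c≡1 |a+c|≡L) ⟩
      rankAmong p Kc 0ℤ ℕ.+ rankAmong p Ka w
    ≡⟨ ℕ.+-comm (rankAmong p Kc 0ℤ) _ ⟩
      rankAmong p Ka w ℕ.+ rankAmong p Kc 0ℤ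
    ≡⟨ cong (rankAmong p Ka w ℕ.+_) (trans (cong (rankAmong p Kc) (sym (+-inverseʳ w)))
                                            (sym (rankAmong-shift p w Kc w))) ⟩
      rankAmong p Ka w ℕ.+ rankAmong p (map (shift w) Kc) w
    ≡⟨ cong (λ ks → rankAmong p Ka w ℕ.+ rankAmong p ks w) (sym (keys-shift r L 0ℤ 0ℤ _ _ c)) ⟩
      rankAmong p Ka w ℕ.+ rankAmong p (keys r L (0ℤ + displacement r a) (0ℤ + + length a) c) w
    ≡⟨ sym (rankAmong-++ p Ka _ w) ⟩
      rankAmong p (Ka ++ keys r L (0ℤ + displacement r a) (0ℤ + + length a) c) w
    ≡⟨ cong (λ ks → rankAmong p ks w) (sym (keys-++ r L 0ℤ 0ℤ a c)) ⟩
      rankAmong p (keys r L 0ℤ 0ℤ (a ++ c)) w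
    ∎
    where
    w  = prefixKey r L a
    Ka = keys r L 0ℤ 0ℤ a
    Kc = keys r L 0ℤ 0ℤ c
    |c+a|≡L : length (c ++ a) ≡ L
    |c+a|≡L = trans (length-++ c) (trans (ℕ.+-comm (length c) (length a)) (trans (sym (length-++ a)) |a+c|≡L))

  startsWith : (Step → Bool) → List Step → Bool
  startsWith p []      = false
  startsWith p (x ∷ _) = p x

  picks : ℕ → (Step → Bool) → ℕ → List Step → Bool
  picks r p k t = startsWith p t ∧ eqℕ (lowSteps r p 0ℤ t) k

  hasRank : (Step → Bool) → List Key → ℕ → Key → Bool
  hasRank p ks k e = p (proj₁ e) ∧ eqℕ (rankAmong p ks (proj₂ e)) k

  orbitSum-picks : ∀ r L p k s → displacement r s ≡ + 1 → length s ≡ L → ∀ a b → a ++ b ≡ s →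
    orbitSum (ind ∘ picks r p k) (length b) (b ++ a)
      ≡ count (hasRank p (keys r L 0ℤ 0ℤ s) k) (keys r L (displacement r a) (+ length a) b)
  orbitSum-picks r L p k s s≡1 |s|≡L a []      _    = refl
  orbitSum-picks r L p k s s≡1 |s|≡L a (y ∷ b) refl = cong₂ ℕ._+_
    (cong (λ n → ind (p y ∧ eqℕ n k)) (lowSteps-rotation r L p a (y ∷ b) s≡1 |s|≡L))
    (begin
      orbitSum (ind ∘ picks r p k) (length b) ((b ++ a) ∷ʳ y)
    ≡⟨ cong (orbitSum (ind ∘ picks r p k) (length b)) (++-assoc b a [ y ]) ⟩
      orbitSum (ind ∘ picks r p k) (length b) (b ++ a ∷ʳ y)
    ≡⟨ orbitSum-picks r L p k s s≡1 |s|≡L (a ∷ʳ y) b (++-assoc a [ y ] b) ⟩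
      count (hasRank p (keys r L 0ℤ 0ℤ (a ++ y ∷ b)) k) (keys r L (displacement r (a ∷ʳ y)) (+ length (a ∷ʳ y)) b)
    ≡⟨ cong₂ (λ h i → count (hasRank p (keys r L 0ℤ 0ℤ (a ++ y ∷ b)) k) (keys r L h i b)) (displacement-∷ʳ r a y) (cong +_ (length-++ a)) ⟩
      count (hasRank p (keys r L 0ℤ 0ℤ (a ++ y ∷ b)) k) (keys r L (displacement r a + δ r y) (+ length a + + 1) b)
    ∎)

  values : (Step → Bool) → List Key → List ℤ
  values p []             = []
  values p ((x , v) ∷ ks) = if p x then v ∷ values p ks else values p ks

  count-values : ∀ p (g : ℤ → Bool) ks → count (λ e → p (proj₁ e) ∧ g (proj₂ e)) ks ≡ count g (values p ks)
  count-values p g []             = refl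
  count-values p g ((x , v) ∷ ks) with p x
  ... | true  = cong (ind (g v) ℕ.+_) (count-values p g ks)
  ... | false = count-values p g ks

  length-values : ∀ p ks → length (values p ks) ≡ count (p ∘ proj₁) ks
  length-values p []             = refl
  length-values p ((x , v) ∷ ks) with p x
  ... | true  = cong suc (length-values p ks)
  ... | false = length-values p ks

  All-values : ∀ p {Q : ℤ → Set} {ks} → All (Q ∘ proj₂) ks → All Q (values p ks)
  All-values p {ks = []}          []         = []
  All-values p {ks = (x , v) ∷ ks} (Qv ∷ Qks) with p x
  ... | true  = Qv ∷ All-values p Qks
  ... | false = All-values p Qks

  values-distinct : ∀ p {ks} → AllPairs (λ e e′ → proj₂ e ≢ proj₂ e′) ks → AllPairs _≢_ (values p ks)
  values-distinct p {[]}             []             = []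
  values-distinct p {(x , v) ∷ ks} (v≢ks ∷ ks≢) with p x
  ... | true  = All-values p v≢ks ∷ values-distinct p ks≢
  ... | false = values-distinct p ks≢

  count-keys : ∀ r L p h i c → count (p ∘ proj₁) (keys r L h i c) ≡ count p c
  count-keys r L p h i []      = refl
  count-keys r L p h i (x ∷ c) = cong (ind (p x) ℕ.+_) (count-keys r L p (h + δ r x) (i + + 1) c)

  KeyIndexedIn : ℕ → ℕ → ℕ → Key → Set
  KeyIndexedIn L lo hi e = Σ ℤ λ h → Σ ℕ λ i → proj₂ e ≡ + L * h - + i × lo ℕ.≤ i × i ℕ.< hi

  keys-indexed : ∀ r L h n c → All (KeyIndexedIn L n (n ℕ.+ length c)) (keys r L h (+ n) c)
  keys-indexed r L h n []      = []
  keys-indexed r L h n (x ∷ c) = (h , n , refl , ℕ.≤-refl , ℕ.m<m+n n (ℕ.s≤s ℕ.z≤n))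
    ∷ All.map (λ (h′ , i , v≡ , lo , hi) → h′ , i , v≡ , ℕ.≤-trans (ℕ.m≤m+n n 1) lo , subst (i ℕ.<_) (ℕ.+-assoc n 1 (length c)) hi)
              (keys-indexed r L (h + δ r x) (n ℕ.+ 1) c)

  index-gap : ∀ L h h′ {n i} → n ℕ.≤ i → + L * h - + n ≡ + L * h′ - + i → + L * (h′ - h) ≡ + (i ℕ.∸ n)
  index-gap L h h′ {n} {i} n≤i eq = begin
      + L * (h′ - h)
    ≡⟨ regroup (+ L) h h′ (+ n) (+ i) ⟩
      (+ L * h′ - + i) - (+ L * h - + n) + (+ i - + n)
    ≡⟨ cong (λ z → z - (+ L * h - + n) + (+ i - + n)) (sym eq) ⟩
      (+ L * h - + n) - (+ L * h - + n) + (+ i - + n)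
    ≡⟨ cancel (+ L * h - + n) (+ i - + n) ⟩
      + i - + n
    ≡⟨ trans (m-n≡m⊖n i n) (⊖-≥ n≤i) ⟩
      + (i ℕ.∸ n)
    ∎
    where
    regroup : ∀ L h h′ n i → L * (h′ - h) ≡ (L * h′ - i) - (L * h - n) + (i - n)
    regroup = solve-∀
    cancel : ∀ x y → x - x + y ≡ y
    cancel = solve-∀

  keys-distinct : ∀ r L h n c → n ℕ.+ length c ℕ.≤ L → AllPairs (λ e e′ → proj₂ e ≢ proj₂ e′) (keys r L h (+ n) c)
  keys-distinct r L h n []      _      = []
  keys-distinct r L h n (x ∷ c) n+c≤L =
    All.map (λ (h′ , i , v≡ , lo , hi) → head≢ h′ i v≡ lo hi) (keys-indexed r L (h + δ r x) (n ℕ.+ 1) c)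
    ∷ keys-distinct r L (h + δ r x) (n ℕ.+ 1) c n+1+c≤L
    where
    n+1+c≤L : n ℕ.+ 1 ℕ.+ length c ℕ.≤ L
    n+1+c≤L = subst (ℕ._≤ L) (sym (ℕ.+-assoc n 1 (length c))) n+c≤L
    head≢ : ∀ {v} h′ i → v ≡ + L * h′ - + i → n ℕ.+ 1 ℕ.≤ i → i ℕ.< n ℕ.+ 1 ℕ.+ length c → + L * h - + n ≢ v
    head≢ h′ i refl lo hi eq = L*d≢j (ℕ.m<n⇒0<n∸m (subst (ℕ._≤ i) (ℕ.+-comm n 1) lo))
                                      (ℕ.≤-<-trans (ℕ.m∸n≤m i n) (ℕ.<-≤-trans hi n+1+c≤L))
                                      (h′ - h) (index-gap L h h′ (ℕ.≤-trans (ℕ.m≤m+n n 1) lo) eq)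

  orbitSum-picks≡1 : ∀ r L p k s → displacement r s ≡ + 1 → length s ≡ L → 1 ℕ.≤ k → k ℕ.≤ count p s →
    orbitSum (ind ∘ picks r p k) L s ≡ 1
  orbitSum-picks≡1 r L p k s s≡1 |s|≡L 1≤k k≤ = begin
      orbitSum (ind ∘ picks r p k) L s
    ≡⟨ cong₂ (orbitSum (ind ∘ picks r p k)) (sym |s|≡L) (sym (++-identityʳ s)) ⟩
      orbitSum (ind ∘ picks r p k) (length s) (s ++ [])
    ≡⟨ orbitSum-picks r L p k s s≡1 |s|≡L [] s refl ⟩
      count (hasRank p K k) K
    ≡⟨ count-values p (λ v → eqℕ (rankAmong p K v) k) K ⟩
      count (λ v → eqℕ (rankAmong p K v) k) V
    ≡⟨ count-cong (λ v → cong (λ n → eqℕ n k) (count-values p (_≤ᵇ v) K)) V ⟩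
      count (λ v → eqℕ (rank v V) k) V
    ≡⟨ rank-hits-once V (values-distinct p (keys-distinct r L 0ℤ 0 s (ℕ.≤-reflexive |s|≡L))) k 1≤k k≤|V| ⟩
      1
    ∎
    where
    K = keys r L 0ℤ 0ℤ s
    V = values p K
    k≤|V| : k ℕ.≤ length V
    k≤|V| = subst (k ℕ.≤_) (sym (trans (length-values p K) (count-keys r L p 0ℤ 0ℤ s))) k≤


module Binomial where

  open import Data.Nat using (_+_; _*_; _/_; NonZero)
  open import Data.Nat.Properties using (*-comm; *-cancelˡ-≡; *-zeroʳ; *-identityʳ; +-identityʳ; *-distribˡ-+; m≤m+n; m+n∸m≡n)
  open import Data.Nat.Combinatorics using (_C_; nCk+nC[k+1]≡[n+1]C[k+1]; nC1≡n; nCk≡nC[n∸k])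
  open import Data.Nat.DivMod using (m*n/n≡m)
  open import Data.Nat.Tactic.RingSolver using (solve-∀)
  open ≡-Reasoning

  [1+k]*[1+m]C[1+k]≡[1+m]*mCk : ∀ m k → suc k * (suc m C suc k) ≡ suc m * (m C k)
  [1+k]*[1+m]C[1+k]≡[1+m]*mCk zero    zero    = refl
  [1+k]*[1+m]C[1+k]≡[1+m]*mCk zero    (suc k) = *-zeroʳ k
  [1+k]*[1+m]C[1+k]≡[1+m]*mCk (suc m) zero    =
    trans (+-identityʳ _) (trans (nC1≡n (suc (suc m))) (sym (*-identityʳ (suc (suc m)))))
  [1+k]*[1+m]C[1+k]≡[1+m]*mCk (suc m) (suc k) = begin
      suc (suc k) * (suc (suc m) C suc (suc k))
    ≡⟨ cong (suc (suc k) *_) (sym (nCk+nC[k+1]≡[n+1]C[k+1] (suc m) (suc k))) ⟩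
      suc (suc k) * (X + Y)
    ≡⟨ regroup k X Y ⟩
      X + (suc k * X + suc (suc k) * Y)
    ≡⟨ cong (X +_) (cong₂ _+_ ([1+k]*[1+m]C[1+k]≡[1+m]*mCk m k) ([1+k]*[1+m]C[1+k]≡[1+m]*mCk m (suc k))) ⟩
      X + (suc m * (m C k) + suc m * (m C suc k))
    ≡⟨ cong (X +_) (sym (*-distribˡ-+ (suc m) (m C k) (m C suc k))) ⟩
      X + suc m * (m C k + m C suc k)
    ≡⟨ cong (λ z → X + suc m * z) (nCk+nC[k+1]≡[n+1]C[k+1] m k) ⟩
      X + suc m * X
    ∎
    where
    X = suc m C suc k
    Y = suc m C suc (suc k)
    regroup : ∀ k X Y → suc (suc k) * (X + Y) ≡ X + (suc k * X + suc (suc k) * Y)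
    regroup = solve-∀

  [1+m]*c≡[1+m]C[1+k]⇒[1+k]*c≡mCk : ∀ m k c → suc m * c ≡ suc m C suc k → suc k * c ≡ m C k
  [1+m]*c≡[1+m]C[1+k]⇒[1+k]*c≡mCk m k c eq = *-cancelˡ-≡ (suc k * c) (m C k) (suc m) (begin
      suc m * (suc k * c)
    ≡⟨ swap (suc m) (suc k) c ⟩
      suc k * (suc m * c)
    ≡⟨ cong (suc k *_) eq ⟩
      suc k * (suc m C suc k)
    ≡⟨ [1+k]*[1+m]C[1+k]≡[1+m]*mCk m k ⟩
      suc m * (m C k)
    ∎)
    where
    swap : ∀ a b c → a * (b * c) ≡ b * (a * c)
    swap = solve-∀

  C-complement : ∀ a b {m} → a + b ≡ m → m C a ≡ m C b
  C-complement a b refl = trans (nCk≡nC[n∸k] (m≤m+n a b)) (cong ((a + b) C_) (m+n∸m≡n a b))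

  *-cancel-/ : ∀ d {c X} .{{_ : NonZero d}} → d * c ≡ X → c ≡ X / d
  *-cancel-/ d {c} d*c≡X = trans (sym (m*n/n≡m c d)) (cong (_/ d) (trans (*-comm c d) d*c≡X))


module Paths where

  open Counting
  open Rotations
  open CycleLemma
  open Binomial
  open import Data.Nat using (_+_; _*_; _∸_; _≤_; _/_; NonZero)
  open import Data.Nat.Properties using (+-comm; +-assoc; +-identityʳ; +-suc; +-cancelˡ-≡; <⇒≱)
  open import Data.Nat.Combinatorics using (_C_)
  open import Data.Nat.Tactic.RingSolver using (solve-∀)
  open import Data.Integer as ℤ using (+_; 0ℤ; _≤ᵇ_)
  import Data.Integer.Properties as ℤ
  import Data.Integer.Tactic.RingSolver as ℤ-Ring
  open ≡-Reasoning

  isP≡eqℕ : ∀ n r s → isP n r s ≡ eqℕ (ups s) (r * n + 1)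
  isP≡eqℕ n r s with ups s ≟ r * n + 1
  ... | yes _ = refl
  ... | no _  = refl

  isP-rotate : ∀ n r s → isP n r (rotate s) ≡ isP n r s
  isP-rotate n r s =
    trans (isP≡eqℕ n r (rotate s)) (trans (cong (λ u → eqℕ u (r * n + 1)) (ups-rotate s)) (sym (isP≡eqℕ n r s)))

  count-isP : ∀ n r m → count (isP n r) (allSeqs m) ≡ m C (r * n + 1)
  count-isP n r m = begin
      count (isP n r) (allSeqs m)
    ≡⟨ count≡sumBy (isP n r) (allSeqs m) ⟩
      sumBy (ind ∘ isP n r) (allSeqs m)
    ≡⟨ sumBy-cong (λ s → cong ind (isP≡eqℕ n r s)) (allSeqs m) ⟩
      sumBy (λ s → ind (eqℕ (ups s) (r * n + 1))) (allSeqs m)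
    ≡⟨ sumBy-allSeqs-ups m (r * n + 1) ⟩
      m C (r * n + 1)
    ∎

  count-id≡ups : ∀ s → count id s ≡ ups s
  count-id≡ups []          = refl
  count-id≡ups (true ∷ s)  = cong suc (count-id≡ups s)
  count-id≡ups (false ∷ s) = count-id≡ups s

  ups+downs : ∀ s → ups s + count not s ≡ length s
  ups+downs []          = refl
  ups+downs (true ∷ s)  = cong suc (ups+downs s)
  ups+downs (false ∷ s) = trans (+-suc (ups s) (count not s)) (cong suc (ups+downs s))

  count-const-true : ∀ (s : List Step) → count (λ _ → true) s ≡ length s
  count-const-true []      = refl
  count-const-true (x ∷ s) = cong suc (count-const-true s)

  displacement≡ups-downs : ∀ r s → displacement r s ≡ + ups s ℤ.- + r ℤ.* + count not s
  displacement≡ups-downs r []          = sym (cong (ℤ._-_ 0ℤ) (ℤ.*-zeroʳ (+ r)))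
  displacement≡ups-downs r (true ∷ s)  =
    trans (cong (ℤ._+_ (+ 1)) (displacement≡ups-downs r s)) (up (+ ups s) (+ r) (+ count not s))
    where
    up : ∀ U R D → + 1 ℤ.+ (U ℤ.- R ℤ.* D) ≡ (+ 1 ℤ.+ U) ℤ.- R ℤ.* D
    up = ℤ-Ring.solve-∀
  displacement≡ups-downs r (false ∷ s) =
    trans (cong (ℤ._+_ (ℤ.- + r)) (displacement≡ups-downs r s)) (down (+ ups s) (+ r) (+ count not s))
    where
    down : ∀ U R D → ℤ.- R ℤ.+ (U ℤ.- R ℤ.* D) ≡ U ℤ.- R ℤ.* (+ 1 ℤ.+ D)
    down = ℤ-Ring.solve-∀

  downs-of-P : ∀ n r s → isP n r s ≡ true → length s ≡ (r + 1) * n + 1 → count not s ≡ n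
  downs-of-P n r s s∈P |s|≡L = +-cancelˡ-≡ (r * n + 1) (count not s) n (begin
      r * n + 1 + count not s
    ≡⟨ cong (_+ count not s) (sym (eqℕ⇒≡ (trans (sym (isP≡eqℕ n r s)) s∈P))) ⟩
      ups s + count not s
    ≡⟨ ups+downs s ⟩
      length s
    ≡⟨ |s|≡L ⟩
      (r + 1) * n + 1
    ≡⟨ regroup r n ⟩
      r * n + 1 + n
    ∎)
    where
    regroup : ∀ r n → (r + 1) * n + 1 ≡ r * n + 1 + n
    regroup = solve-∀

  displacement-of-P : ∀ n r s → isP n r s ≡ true → length s ≡ (r + 1) * n + 1 → displacement r s ≡ + 1
  displacement-of-P n r s s∈P |s|≡L = begin
      displacement r s
    ≡⟨ displacement≡ups-downs r s ⟩
      + ups s ℤ.- + r ℤ.* + count not s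
    ≡⟨ cong₂ (λ u d → + u ℤ.- + r ℤ.* + d) (eqℕ⇒≡ (trans (sym (isP≡eqℕ n r s)) s∈P)) (downs-of-P n r s s∈P |s|≡L) ⟩
      + (r * n + 1) ℤ.- + r ℤ.* + n
    ≡⟨ cong (ℤ._- + r ℤ.* + n) (trans (ℤ.pos-+ (r * n) 1) (cong (ℤ._+ + 1) (ℤ.pos-* r n))) ⟩
      + r ℤ.* + n ℤ.+ + 1 ℤ.- + r ℤ.* + n
    ≡⟨ cancel (+ r ℤ.* + n) (+ 1) ⟩
      + 1
    ∎
    where
    cancel : ∀ x y → x ℤ.+ y ℤ.- x ≡ y
    cancel = ℤ-Ring.solve-∀

  L*count-P-picks : ∀ n r (g : List Step → Bool) p k → 1 ≤ k →
    (∀ s → isP n r s ≡ true → length s ≡ (r + 1) * n + 1 → k ≤ count p s) →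
    (∀ t → displacement r t ≡ + 1 → g t ≡ picks r p k t) →
    suc ((r + 1) * n) * count g (P n r) ≡ suc ((r + 1) * n) C suc (r * n)
  L*count-P-picks n r g p k 1≤k k≤count g≡picks = begin
      suc ((r + 1) * n) * count g (P n r)
    ≡⟨ cong (_* count g (P n r)) (+-comm 1 ((r + 1) * n)) ⟩
      ((r + 1) * n + 1) * count g (P n r)
    ≡⟨ count-filter-by-orbits ((r + 1) * n + 1) (isP n r) g (isP-rotate n r) one-per-orbit ⟩
      count (isP n r) (allSeqs ((r + 1) * n + 1))
    ≡⟨ count-isP n r ((r + 1) * n + 1) ⟩
      ((r + 1) * n + 1) C (r * n + 1)
    ≡⟨ cong₂ _C_ (+-comm ((r + 1) * n) 1) (+-comm (r * n) 1) ⟩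
      suc ((r + 1) * n) C suc (r * n)
    ∎
    where
    one-per-orbit : ∀ s → length s ≡ (r + 1) * n + 1 → isP n r s ≡ true → orbitSum (ind ∘ g) ((r + 1) * n + 1) s ≡ 1
    one-per-orbit s |s|≡L s∈P = trans
      (orbitSum-cong (λ t → displacement r t ≡ + 1) (λ {t} t≡1 → trans (displacement-rotate r t) t≡1)
                     (λ {t} t≡1 → cong ind (g≡picks t t≡1)) ((r + 1) * n + 1) s≡1)
      (orbitSum-picks≡1 r ((r + 1) * n + 1) p k s s≡1 |s|≡L 1≤k (k≤count s s∈P |s|≡L))
      where
      s≡1 = displacement-of-P n r s s∈P |s|≡L

  upsBelowFrom≡lowSteps : ∀ r h t → upsBelowFrom r h t ≡ lowSteps r id h t
  upsBelowFrom≡lowSteps r h []          = refl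
  upsBelowFrom≡lowSteps r h (true ∷ t)  = cong (_+_ (ind (h ≤ᵇ 0ℤ))) (upsBelowFrom≡lowSteps r _ t)
  upsBelowFrom≡lowSteps r h (false ∷ t) = upsBelowFrom≡lowSteps r _ t

  downsBelowFrom≡lowSteps : ∀ r h t → downsBelowFrom r h t ≡ lowSteps r not h t
  downsBelowFrom≡lowSteps r h []          = refl
  downsBelowFrom≡lowSteps r h (true ∷ t)  = downsBelowFrom≡lowSteps r _ t
  downsBelowFrom≡lowSteps r h (false ∷ t) = cong (_+_ (ind (h ≤ᵇ 0ℤ))) (downsBelowFrom≡lowSteps r _ t)

  verticesBelowFrom≡lowSteps : ∀ r h t →
    verticesBelowFrom r h t ≡ lowSteps r (λ _ → true) h t + ind (h ℤ.+ displacement r t ≤ᵇ 0ℤ)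
  verticesBelowFrom≡lowSteps r h []      = cong (λ v → ind (v ≤ᵇ 0ℤ)) (sym (ℤ.+-identityʳ h))
  verticesBelowFrom≡lowSteps r h (x ∷ t) = begin
      ind (h ≤ᵇ 0ℤ) + verticesBelowFrom r (h ℤ.+ δ r x) t
    ≡⟨ cong (_+_ (ind (h ≤ᵇ 0ℤ))) (verticesBelowFrom≡lowSteps r (h ℤ.+ δ r x) t) ⟩
      ind (h ≤ᵇ 0ℤ) + (lowSteps r (λ _ → true) (h ℤ.+ δ r x) t + ind (h ℤ.+ δ r x ℤ.+ displacement r t ≤ᵇ 0ℤ))
    ≡⟨ sym (+-assoc (ind (h ≤ᵇ 0ℤ)) _ _) ⟩
      ind (h ≤ᵇ 0ℤ) + lowSteps r (λ _ → true) (h ℤ.+ δ r x) t + ind (h ℤ.+ δ r x ℤ.+ displacement r t ≤ᵇ 0ℤ)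
    ≡⟨ cong (λ v → lowSteps r (λ _ → true) h (x ∷ t) + ind (v ≤ᵇ 0ℤ)) (ℤ.+-assoc h (δ r x) (displacement r t)) ⟩
      lowSteps r (λ _ → true) h (x ∷ t) + ind (h ℤ.+ displacement r (x ∷ t) ≤ᵇ 0ℤ)
    ∎

  startsUp≡startsWith : ∀ t → startsUp t ≡ startsWith id t
  startsUp≡startsWith []          = refl
  startsUp≡startsWith (true ∷ t)  = refl
  startsUp≡startsWith (false ∷ t) = refl

  startsDown≡startsWith : ∀ t → startsDown t ≡ startsWith not t
  startsDown≡startsWith []          = refl
  startsDown≡startsWith (true ∷ t)  = refl
  startsDown≡startsWith (false ∷ t) = refl

  L*count-upsBelow : ∀ n r k → 1 ≤ k → k ≤ r * n + 1 →
    suc ((r + 1) * n) * count (λ s → startsUp s ∧ eqℕ (upsBelow r s) k) (P n r) ≡ suc ((r + 1) * n) C suc (r * n)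
  L*count-upsBelow n r k 1≤k k≤ = L*count-P-picks n r _ id k 1≤k
    (λ s s∈P _ → subst (k ≤_) (sym (trans (count-id≡ups s) (eqℕ⇒≡ (trans (sym (isP≡eqℕ n r s)) s∈P)))) k≤)
    (λ t _ → cong₂ (λ b l → b ∧ eqℕ l k) (startsUp≡startsWith t) (upsBelowFrom≡lowSteps r 0ℤ t))

  L*count-downsBelow : ∀ n r k → 1 ≤ k → k ≤ n →
    suc ((r + 1) * n) * count (λ s → startsDown s ∧ eqℕ (downsBelow r s) k) (P n r) ≡ suc ((r + 1) * n) C suc (r * n)
  L*count-downsBelow n r k 1≤k k≤n = L*count-P-picks n r _ not k 1≤k
    (λ s s∈P |s|≡L → subst (k ≤_) (sym (downs-of-P n r s s∈P |s|≡L)) k≤n)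
    (λ t _ → cong₂ (λ b l → b ∧ eqℕ l k) (startsDown≡startsWith t) (downsBelowFrom≡lowSteps r 0ℤ t))

  L*count-verticesBelow : ∀ n r k → 1 ≤ k → k ≤ (r + 1) * n + 1 →
    suc ((r + 1) * n) * count (λ s → eqℕ (verticesBelow r s) k) (P n r) ≡ suc ((r + 1) * n) C suc (r * n)
  L*count-verticesBelow n r k 1≤k k≤ = L*count-P-picks n r _ (λ _ → true) k 1≤k
    (λ s _ |s|≡L → subst (k ≤_) (sym (trans (count-const-true s) |s|≡L)) k≤)
    vertices≡picks
    where
    vertices≡picks : ∀ t → displacement r t ≡ + 1 → eqℕ (verticesBelow r t) k ≡ picks r (λ _ → true) k t
    vertices≡picks []      ()
    vertices≡picks (x ∷ t) t≡1 = cong (λ v → eqℕ v k) (begin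
        verticesBelow r (x ∷ t)
      ≡⟨ verticesBelowFrom≡lowSteps r 0ℤ (x ∷ t) ⟩
        lowSteps r (λ _ → true) 0ℤ (x ∷ t) + ind (0ℤ ℤ.+ displacement r (x ∷ t) ≤ᵇ 0ℤ)
      ≡⟨ cong (λ d → lowSteps r (λ _ → true) 0ℤ (x ∷ t) + ind (0ℤ ℤ.+ d ≤ᵇ 0ℤ)) t≡1 ⟩
        lowSteps r (λ _ → true) 0ℤ (x ∷ t) + 0
      ≡⟨ +-identityʳ _ ⟩
        lowSteps r (λ _ → true) 0ℤ (x ∷ t)
      ∎)

  [r+1]*n≡r*n+n : ∀ r n → (r + 1) * n ≡ r * n + n
  [r+1]*n≡r*n+n = solve-∀

  count-upsBelow : ∀ n r k → 1 ≤ k → k ≤ r * n + 1 →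
    count (λ s → startsUp s ∧ eqℕ (upsBelow r s) k) (P n r) ≡ ((r + 1) * n C n) / (1 + r * n)
  count-upsBelow n r k 1≤k k≤ = *-cancel-/ (1 + r * n)
    (trans ([1+m]*c≡[1+m]C[1+k]⇒[1+k]*c≡mCk ((r + 1) * n) (r * n) _ (L*count-upsBelow n r k 1≤k k≤))
           (C-complement (r * n) n (sym ([r+1]*n≡r*n+n r n))))

  count-downsBelow : ∀ n r .{{_ : NonZero n}} k → 1 ≤ k → k ≤ n →
    count (λ s → startsDown s ∧ eqℕ (downsBelow r s) k) (P n r) ≡ ((r + 1) * n C (n ∸ 1)) / n
  count-downsBelow zero        r k 1≤k k≤0 = ⊥-elim (<⇒≱ 1≤k k≤0)
  count-downsBelow n@(suc n′) r k 1≤k k≤n = *-cancel-/ n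
    ([1+m]*c≡[1+m]C[1+k]⇒[1+k]*c≡mCk ((r + 1) * n) n′ _
      (trans (L*count-downsBelow n r k 1≤k k≤n) (C-complement (suc (r * n)) n (cong suc (sym ([r+1]*n≡r*n+n r n))))))

  count-verticesBelow : ∀ n r k → 1 ≤ k → k ≤ (r + 1) * n + 1 →
    count (λ s → eqℕ (verticesBelow r s) k) (P n r) ≡ (((r + 1) * n + 1) C n) / (1 + (r + 1) * n)
  count-verticesBelow n r k 1≤k k≤ = *-cancel-/ (1 + (r + 1) * n)
    (trans (L*count-verticesBelow n r k 1≤k k≤)
           (trans (C-complement (suc (r * n)) n (cong suc (sym ([r+1]*n≡r*n+n r n)))) (cong (_C n) (+-comm 1 ((r + 1) * n)))))


open Paths using (count-upsBelow; count-downsBelow; count-verticesBelow)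
open import Data.Nat using (_+_; _*_; _∸_; _≤_; _/_; NonZero)
open import Data.Nat.Combinatorics using (_C_)

theorem13 : (n r : ℕ) → .{{_ : NonZero n}} → .{{_ : NonZero r}} →
    ((k : ℕ) → 1 ≤ k → k ≤ r * n + 1 →
      count (λ s → startsUp s ∧ eqℕ (upsBelow r s) k) (P n r)
        ≡ ((r + 1) * n C n) / (1 + r * n))
    × ((k : ℕ) → 1 ≤ k → k ≤ n →
      count (λ s → startsDown s ∧ eqℕ (downsBelow r s) k) (P n r)
        ≡ ((r + 1) * n C (n ∸ 1)) / n)
    × ((k : ℕ) → 1 ≤ k → k ≤ (r + 1) * n + 1 →
      count (λ s → eqℕ (verticesBelow r s) k) (P n r)
        ≡ (((r + 1) * n + 1) C n) / (1 + (r + 1) * n))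
theorem13 n r = count-upsBelow n r , count-downsBelow n r , count-verticesBelow n r
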